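{- Let $g$ be the morphism on the alphabet $\{a,0,1,\alpha\}$ defined by $a\mapsto a0\alpha$, $0\mapsto01$, $1\mapsto10$, $\alpha\mapsto\alpha\alpha$, and let $\mathbf{g}=g^{\omega}(a)=a\prod_{j\ge0}\varphi^j(0)\alpha^{2^j}$ be its fixed point starting with $a$ (here $\varphi$ is $0\mapsto01$, $1\mapsto10$). Then the abelian complexity of $\mathbf{g}$ is unbounded and $b^{(k)}_{\mathbf{g}}\prec b^{(k+1)}_{\mathbf{g}}$ for all $k\ge1$.
   Context: For words $u,w$, $\binom{u}{w}$ is the number of occurrences of $w$ as a scattered subword of $u$; $u\sim_k v$ if $\binom{u}{x}=\binom{v}{x}$ for all words $x$ of length at most $k$. $b^{(k)}_{\mathbf{x}}(n)$ is the number of $\sim_k$-classes among length-$n$ factors of $\mathbf{x}$ (for $k=1$, the abelian complexity). For $f,h\colon\mathbb{N}\to\mathbb{N}$, $f\prec h$ means $f(n)<h(n)$ for infinitely many $n$. -}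

module Defs where

open import Data.Nat using (ℕ; zero; suc; _+_; _≤_; _<_)
open import Data.Fin using (Fin)
open import Data.List using (List; []; _∷_; _++_; concatMap; length)
open import Data.Product using (Σ; ∃; _×_; _,_)
open import Relation.Binary.PropositionalEquality using (_≡_; refl)
open import Relation.Nullary using (¬_; Dec; yes; no)

data Letter : Set where
  a  : Letter
  l0 : Letter
  l1 : Letter
  α  : Letter

_≟L_ : (x y : Letter) → Dec (x ≡ y)
a  ≟L a  = yes refl
a  ≟L l0 = no λ ()
a  ≟L l1 = no λ ()
a  ≟L α  = no λ ()
l0 ≟L a  = no λ ()
l0 ≟L l0 = yes refl
l0 ≟L l1 = no λ ()
l0 ≟L α  = no λ ()
l1 ≟L a  = no λ ()
l1 ≟L l0 = no λ ()
l1 ≟L l1 = yes refl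
l1 ≟L α  = no λ ()
α  ≟L a  = no λ ()
α  ≟L l0 = no λ ()
α  ≟L l1 = no λ ()
α  ≟L α  = yes refl

Word : Set
Word = List Letter

gL : Letter → Word
gL a  = a ∷ l0 ∷ α ∷ []
gL l0 = l0 ∷ l1 ∷ []
gL l1 = l1 ∷ l0 ∷ []
gL α  = α ∷ α ∷ []

g : Word → Word
g = concatMap gL

gIter : ℕ → Word
gIter zero    = a ∷ []
gIter (suc j) = g (gIter j)

-- list lookup with a default letter (only used where the index is in range)
nth : ℕ → Word → Letter
nth _       []       = a
nth zero    (x ∷ _)  = x
nth (suc i) (_ ∷ xs) = nth i xs

-- The fixed point 𝐠 = g^ω(a), as an infinite word ℕ → Letter.
-- g^(i+1)(a) is a prefix of 𝐠 of length > i, so its i-th letter is 𝐠(i).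
gω : ℕ → Letter
gω i = nth i (gIter (suc i))

factor : (ℕ → Letter) → ℕ → ℕ → Word
factor x i zero    = []
factor x i (suc n) = x i ∷ factor x (suc i) n

binom : Word → Word → ℕ
binom u       []      = 1
binom []      (_ ∷ _) = 0
binom (c ∷ u) (d ∷ w) with c ≟L d
... | yes _ = binom u (d ∷ w) + binom u w
... | no  _ = binom u (d ∷ w)

_∼[_]_ : Word → ℕ → Word → Set
u ∼[ k ] v = (x : Word) → length x ≤ k → binom u x ≡ binom v x

-- HasClassCount x k n m  :  b^(k)_x(n) = m, i.e. the length-n factors of x
-- fall into exactly m classes of ∼k: there are m factors (given by starting
-- positions) that are pairwise non-equivalent and every length-n factor is
-- equivalent to one of them.
HasClassCount : (ℕ → Letter) → ℕ → ℕ → ℕ → Set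
HasClassCount x k n m =
  Σ (Fin m → ℕ) λ pos →
    ((p q : Fin m) → factor x (pos p) n ∼[ k ] factor x (pos q) n → p ≡ q)
  × ((i : ℕ) → ∃ λ (p : Fin m) → factor x i n ∼[ k ] factor x (pos p) n)

Prec : (ℕ → Letter) → ℕ → ℕ → Set
Prec x k k' = (N : ℕ) → Σ ℕ λ n → N ≤ n × Σ ℕ λ m → Σ ℕ λ m' →
  HasClassCount x k n m × HasClassCount x k' n m' × m < m'

AbelianUnbounded : (ℕ → Letter) → Set
AbelianUnbounded x = (B : ℕ) → Σ ℕ λ n → Σ ℕ λ m → HasClassCount x 1 n m × B < m

{-# OPTIONS --safe #-}
-- For p ≥ 1 the fixed point satisfies gω(2p+1) = gω(p) and gω(2p+2) = compl (gω p), so the factor of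
-- length 2L at 2p+1 is the g-image of the factor of length L at p. Hence all factors of a given length
-- occur before some bound, which makes every b⁽ᵏ⁾(n) a finite count.
-- Moreover gω = a · φ⁰(0) · α · φ¹(0) · α² · φ²(0) · α⁴ ⋯, so every suffix of φʲ(0) followed by up to 2ʲ
-- letters α is a factor. Suffixes of length B − t give factors of length B with exactly t letters α,
-- whence b⁽¹⁾(B) > B. For k ≥ 1, φᵏ(0) and its complement are k- but not (k+1)-binomially equivalent
-- (uv ∼ₖ₊₁ vu whenever u ∼ₖ v, and the word 0 1ᵏ separates them); both occur followed by αᴺ for all N,
-- and α-runs do not change the coefficients of α-free words, so some k-class splits at level k + 1
-- for every length 2ᵏ + N.
module Submission where

open import Defs
open import Data.Nat
open import Data.Nat.Properties
open import Data.Nat.Induction using (<-rec)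
open import Data.Nat.Combinatorics using (_C_; nCk+nC[k+1]≡[n+1]C[k+1])
open import Data.Nat.Solver using (module +-*-Solver)
open import Data.Fin as Fin using (Fin; toℕ)
open import Data.Fin.Properties using (any?; pigeonhole; toℕ-injective; toℕ<n) renaming (<⇒≢ to <⇒≢ᶠ)
open import Data.List using ([]; _∷_; _++_; length; map; replicate; take; drop)
open import Data.List.Properties
  using (++-assoc; length-++; ∷-injective; ∷-injectiveˡ; ∷-injectiveʳ; map-++; map-∘; map-cong; map-id; length-map; length-drop;
         length-replicate; take++drop≡id)
open import Data.List.Relation.Unary.All using (All; []; _∷_)
open import Data.List.Relation.Unary.All.Properties using (++⁻ʳ; replicate⁺)
open import Data.Product using (Σ; ∃; _×_; _,_; proj₁; proj₂; map₁)
open import Data.Sum using (_⊎_; inj₁; inj₂)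
open import Data.Empty using (⊥; ⊥-elim)
open import Data.Unit using (⊤; tt)
open import Relation.Binary.PropositionalEquality
open import Relation.Nullary using (¬_; Dec; yes; no)
open import Relation.Nullary.Decidable using (map′; _×-dec_)

-- Self-similarity of gω

double : ℕ → ℕ
double zero    = zero
double (suc n) = suc (suc (double n))

n≤double : ∀ n → n ≤ double n
n≤double zero    = z≤n
n≤double (suc n) = s≤s (m≤n⇒m≤1+n (n≤double n))

compl : Letter → Letter
compl a  = a
compl l0 = l1
compl l1 = l0
compl α  = α

NotA : Letter → Set
NotA a = ⊥
NotA _ = ⊤

gL-NotA : ∀ c → NotA c → gL c ≡ c ∷ compl c ∷ []
gL-NotA l0 _ = refl
gL-NotA l1 _ = refl
gL-NotA α  _ = refl

g-++ : ∀ u v → g (u ++ v) ≡ g u ++ g v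
g-++ []      v = refl
g-++ (c ∷ u) v = trans (cong (gL c ++_) (g-++ u v)) (sym (++-assoc (gL c) (g u) (g v)))

length≤length-g : ∀ w → length w ≤ length (g w)
length≤length-g []       = z≤n
length≤length-g (a ∷ w)  = s≤s (m≤n⇒m≤1+n (m≤n⇒m≤1+n (length≤length-g w)))
length≤length-g (l0 ∷ w) = s≤s (m≤n⇒m≤1+n (length≤length-g w))
length≤length-g (l1 ∷ w) = s≤s (m≤n⇒m≤1+n (length≤length-g w))
length≤length-g (α ∷ w)  = s≤s (m≤n⇒m≤1+n (length≤length-g w))

All-NotA-g : ∀ {w} → All NotA w → All NotA (g w)
All-NotA-g {[]}     []      = []
All-NotA-g {l0 ∷ w} (_ ∷ h) = tt ∷ tt ∷ All-NotA-g h
All-NotA-g {l1 ∷ w} (_ ∷ h) = tt ∷ tt ∷ All-NotA-g h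
All-NotA-g {α ∷ w}  (_ ∷ h) = tt ∷ tt ∷ All-NotA-g h

gIter-extends : ∀ j → Σ Word λ r → gIter (suc j) ≡ gIter j ++ r × 1 ≤ length r
gIter-extends zero    = l0 ∷ α ∷ [] , refl , s≤s z≤n
gIter-extends (suc j) with gIter-extends j
... | r , e , r≢[] = g r , trans (cong g e) (g-++ (gIter j) r) , ≤-trans r≢[] (length≤length-g r)

length-gIter-mono : ∀ d j → length (gIter j) ≤ length (gIter (d + j))
length-gIter-mono zero    j = ≤-refl
length-gIter-mono (suc d) j with gIter-extends (d + j)
... | r , e , _ = begin
  length (gIter j)                  ≤⟨ length-gIter-mono d j ⟩
  length (gIter (d + j))            ≤⟨ m≤m+n _ _ ⟩
  length (gIter (d + j)) + length r ≡⟨ sym (trans (cong length e) (length-++ (gIter (d + j)))) ⟩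
  length (gIter (suc d + j))        ∎
  where open ≤-Reasoning

suc≤length-gIter : ∀ j → suc j ≤ length (gIter j)
suc≤length-gIter zero    = s≤s z≤n
suc≤length-gIter (suc j) with gIter-extends j
... | r , e , r≢[] = begin
  suc (suc j)                  ≡⟨ +-comm 1 (suc j) ⟩
  suc j + 1                    ≤⟨ +-mono-≤ (suc≤length-gIter j) r≢[] ⟩
  length (gIter j) + length r  ≡⟨ sym (trans (cong length e) (length-++ (gIter j))) ⟩
  length (gIter (suc j))       ∎
  where open ≤-Reasoning

nth-++ : ∀ i (xs ys : Word) → i < length xs → nth i (xs ++ ys) ≡ nth i xs
nth-++ zero    (x ∷ xs) ys _       = refl
nth-++ (suc i) (x ∷ xs) ys (s≤s h) = nth-++ i xs ys h

nth-gIter-stable : ∀ i j d → i < length (gIter j) → nth i (gIter (d + j)) ≡ nth i (gIter j)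
nth-gIter-stable i j zero    h = refl
nth-gIter-stable i j (suc d) h with gIter-extends (d + j)
... | r , e , _ = begin
  nth i (gIter (suc d + j))       ≡⟨ cong (nth i) e ⟩
  nth i (gIter (d + j) ++ r)      ≡⟨ nth-++ i (gIter (d + j)) r (≤-trans h (length-gIter-mono d j)) ⟩
  nth i (gIter (d + j))           ≡⟨ nth-gIter-stable i j d h ⟩
  nth i (gIter j)                 ∎
  where open ≡-Reasoning

gω≡nth-gIter : ∀ {p m} → p < m → gω p ≡ nth p (gIter m)
gω≡nth-gIter {p} {m} p<m = begin
  nth p (gIter (suc p))                ≡⟨ nth-gIter-stable p (suc p) (m ∸ suc p) p<length ⟨
  nth p (gIter (m ∸ suc p + suc p))    ≡⟨ cong (λ j → nth p (gIter j)) (m∸n+n≡m p<m) ⟩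
  nth p (gIter m)                      ∎
  where
  open ≡-Reasoning
  p<length : p < length (gIter (suc p))
  p<length = ≤-trans (n≤1+n (suc p)) (suc≤length-gIter (suc p))

-- The tail of g^j(a) avoids a, so on it g acts letterwise by c ↦ c (compl c).
gTail : ℕ → Word
gTail zero    = []
gTail (suc j) = l0 ∷ α ∷ g (gTail j)

gIter≡a∷gTail : ∀ j → gIter j ≡ a ∷ gTail j
gIter≡a∷gTail zero    = refl
gIter≡a∷gTail (suc j) = cong g (gIter≡a∷gTail j)

All-NotA-gTail : ∀ j → All NotA (gTail j)
All-NotA-gTail zero    = []
All-NotA-gTail (suc j) = tt ∷ tt ∷ All-NotA-g (All-NotA-gTail j)

j≤length-gTail : ∀ j → j ≤ length (gTail j)
j≤length-gTail j = s≤s⁻¹ (subst (λ w → suc j ≤ length w) (gIter≡a∷gTail j) (suc≤length-gIter j))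

nth-NotA : ∀ {q w} → All NotA w → q < length w → NotA (nth q w)
nth-NotA {zero}  (h ∷ _)  _       = h
nth-NotA {suc q} (_ ∷ hs) (s≤s l) = nth-NotA hs l

nth-g : ∀ {q w} → All NotA w → q < length w →
        nth (double q) (g w) ≡ nth q w × nth (suc (double q)) (g w) ≡ compl (nth q w)
nth-g {zero}  {l0 ∷ w} _       _       = refl , refl
nth-g {zero}  {l1 ∷ w} _       _       = refl , refl
nth-g {zero}  {α ∷ w}  _       _       = refl , refl
nth-g {_}     {a ∷ w}  (() ∷ _) _
nth-g {suc q} {l0 ∷ w} (_ ∷ h) (s≤s l) = nth-g h l
nth-g {suc q} {l1 ∷ w} (_ ∷ h) (s≤s l) = nth-g h l
nth-g {suc q} {α ∷ w}  (_ ∷ h) (s≤s l) = nth-g h l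

gω-suc-NotA : ∀ q → NotA (gω (suc q))
gω-suc-NotA q = subst (λ w → NotA (nth (suc q) w)) (sym (gIter≡a∷gTail (2 + q)))
  (nth-NotA (All-NotA-gTail (2 + q)) (≤-trans (n≤1+n _) (j≤length-gTail (2 + q))))

gω-double : ∀ p → 1 ≤ p → gω (suc (double p)) ≡ gω p × gω (suc (suc (double p))) ≡ compl (gω p)
gω-double (suc q) _ =
  trans (gω≡nth-gIter {m = suc m} (s≤s (n≤1+n _))) (trans (proj₁ step) (sym (gω≡nth-gIter p<m))) ,
  trans (gω≡nth-gIter {m = suc m} ≤-refl) (trans (proj₂ step) (cong compl (sym (gω≡nth-gIter p<m))))
  where
  p = suc q
  m = suc (suc (double p))
  p<m : p < m
  p<m = s≤s (m≤n⇒m≤1+n (n≤double p))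
  step : nth (suc (double p)) (gIter (suc m)) ≡ nth p (gIter m)
       × nth (suc (suc (double p))) (gIter (suc m)) ≡ compl (nth p (gIter m))
  step rewrite gIter≡a∷gTail m = nth-g (All-NotA-gTail m) (≤-trans (≤-trans (n≤1+n p) p<m) (j≤length-gTail m))

factor-++ : ∀ (x : ℕ → Letter) i m n → factor x i (m + n) ≡ factor x i m ++ factor x (m + i) n
factor-++ x i zero    n = refl
factor-++ x i (suc m) n = cong (x i ∷_)
  (trans (factor-++ x (suc i) m n) (cong (λ j → factor x (suc i) m ++ factor x j n) (+-suc m i)))

length-factor : ∀ (x : ℕ → Letter) i n → length (factor x i n) ≡ n
length-factor x i zero    = refl
length-factor x i (suc n) = cong suc (length-factor x (suc i) n)

++-injective : ∀ {A A′ B B′ : Word} → length A ≡ length A′ → A ++ B ≡ A′ ++ B′ → A ≡ A′ × B ≡ B′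
++-injective {[]}    {[]}     _ e = refl , e
++-injective {c ∷ A} {c′ ∷ A′} l e with ∷-injective e
... | refl , e′ = map₁ (cong (c ∷_)) (++-injective (suc-injective l) e′)

factor-++⁻ : ∀ (x : ℕ → Letter) i {m n} {X Y : Word} → length X ≡ m → factor x i (m + n) ≡ X ++ Y →
             factor x i m ≡ X × factor x (m + i) n ≡ Y
factor-++⁻ x i {m} {n} lX e = ++-injective (trans (length-factor x i m) (sym lX)) (trans (sym (factor-++ x i m n)) e)

factor-prefix-≤ : ∀ {x : ℕ → Letter} {i i′ m n} → n ≤ m →
                  factor x i m ≡ factor x i′ m → factor x i n ≡ factor x i′ n
factor-prefix-≤ {x} {i} {i′} {m} {n} n≤m e = proj₁ (++-injective
  (trans (length-factor x i n) (sym (length-factor x i′ n)))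
  (trans (sym (split i)) (trans e (split i′))))
  where
  split : ∀ j → factor x j m ≡ factor x j n ++ factor x (n + j) (m ∸ n)
  split j = trans (cong (factor x j) (sym (m+[n∸m]≡n n≤m))) (factor-++ x j n (m ∸ n))

factor-double : ∀ p L → 1 ≤ p → factor gω (suc (double p)) (double L) ≡ g (factor gω p L)
factor-double p       zero    _ = refl
factor-double (suc q) (suc L) h with gω-double (suc q) h
... | odd , even = begin
  gω (suc (double (suc q))) ∷ gω (2 + double (suc q)) ∷ factor gω (suc (double (2 + q))) (double L)
    ≡⟨ cong₂ (λ c d → c ∷ d ∷ factor gω (suc (double (2 + q))) (double L)) odd even ⟩
  gω (suc q) ∷ compl (gω (suc q)) ∷ factor gω (suc (double (2 + q))) (double L)
    ≡⟨ cong₂ _++_ (sym (gL-NotA (gω (suc q)) (gω-suc-NotA q))) (factor-double (2 + q) L (s≤s z≤n)) ⟩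
  g (factor gω (suc q) (suc L)) ∎
  where open ≡-Reasoning

-- Factors of gω occur before a bound

FactorsBefore : (ℕ → Letter) → ℕ → ℕ → Set
FactorsBefore x n B = ∀ i → ∃ λ i′ → i′ < B × factor x i n ≡ factor x i′ n

FactorsBefore-≤ : ∀ {x m n B} → n ≤ m → FactorsBefore x m B → FactorsBefore x n B
FactorsBefore-≤ n≤m cover i with cover i
... | i′ , i′<B , e = i′ , i′<B , factor-prefix-≤ n≤m e

odd-or-even≥3 : ∀ j → ∃ λ q → 3 + j ≡ suc (double (suc q)) ⊎ 3 + j ≡ 2 + double (suc q)
odd-or-even≥3 zero          = 0 , inj₁ refl
odd-or-even≥3 (suc zero)    = 0 , inj₂ refl
odd-or-even≥3 (suc (suc j)) with odd-or-even≥3 j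
... | q , inj₁ e = suc q , inj₁ (cong (2 +_) e)
... | q , inj₂ e = suc q , inj₂ (cong (2 +_) e)

2+double-mono : ∀ {m n} → m < n → 2 + double m ≤ double n
2+double-mono {zero}  {suc n} _         = s≤s (s≤s z≤n)
2+double-mono {suc m} {suc n} (s≤s m<n) = s≤s (s≤s (2+double-mono m<n))

Factor₂ : Letter → Letter → Set
Factor₂ a  l0 = ⊤
Factor₂ l0 α  = ⊤
Factor₂ α  l0 = ⊤
Factor₂ l0 l1 = ⊤
Factor₂ l1 α  = ⊤
Factor₂ α  α  = ⊤
Factor₂ l1 l1 = ⊤
Factor₂ l1 l0 = ⊤
Factor₂ l0 l0 = ⊤
Factor₂ _  _  = ⊥

Factor₂-image : ∀ c → NotA c → Factor₂ c (compl c)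
Factor₂-image l0 _ = tt
Factor₂-image l1 _ = tt
Factor₂-image α  _ = tt

Factor₂-compl : ∀ c d → NotA c → Factor₂ c d → Factor₂ (compl c) d
Factor₂-compl l0 α  _ _ = tt
Factor₂-compl α  l0 _ _ = tt
Factor₂-compl l0 l1 _ _ = tt
Factor₂-compl l1 α  _ _ = tt
Factor₂-compl α  α  _ _ = tt
Factor₂-compl l1 l1 _ _ = tt
Factor₂-compl l1 l0 _ _ = tt
Factor₂-compl l0 l0 _ _ = tt

Factor₂-gω : ∀ i → Factor₂ (gω i) (gω (suc i))
Factor₂-gω = <-rec (λ i → Factor₂ (gω i) (gω (suc i))) step
  where
  step : ∀ i → (∀ {i′} → i′ < i → Factor₂ (gω i′) (gω (suc i′))) → Factor₂ (gω i) (gω (suc i))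
  step 0 _ = tt
  step 1 _ = tt
  step 2 _ = tt
  step (suc (suc (suc j))) ih with odd-or-even≥3 j
  ... | q , inj₁ e with gω-double (suc q) (s≤s z≤n)
  ... | odd , even = subst (λ i → Factor₂ (gω i) (gω (suc i))) (sym e)
    (subst₂ Factor₂ (sym odd) (sym even) (Factor₂-image (gω (suc q)) (gω-suc-NotA q)))
  step (suc (suc (suc j))) ih | q , inj₂ e
    with gω-double (suc q) (s≤s z≤n) | gω-double (suc (suc q)) (s≤s z≤n)
  ... | _ , even | odd , _ = subst (λ i → Factor₂ (gω i) (gω (suc i))) (sym e)
    (subst₂ Factor₂ (sym even) (sym odd) (Factor₂-compl (gω (suc q)) (gω (suc (suc q))) (gω-suc-NotA q)
      (ih (subst (suc q <_) (sym e) (m≤n⇒m≤1+n (s≤s (n≤double (suc q))))))))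

Factor₂-occurs : ∀ c d → Factor₂ c d → ∃ λ i → i < 21 × gω i ≡ c × gω (suc i) ≡ d
Factor₂-occurs a  l0 _ = 0  , s≤s z≤n , refl , refl
Factor₂-occurs l0 α  _ = 1  , s≤s (s≤s z≤n) , refl , refl
Factor₂-occurs α  l0 _ = 2  , s≤s (s≤s (s≤s z≤n)) , refl , refl
Factor₂-occurs l0 l1 _ = 3  , m≤m+n 4 17 , refl , refl
Factor₂-occurs l1 α  _ = 4  , m≤m+n 5 16 , refl , refl
Factor₂-occurs α  α  _ = 5  , m≤m+n 6 15 , refl , refl
Factor₂-occurs l1 l1 _ = 8  , m≤m+n 9 12 , refl , refl
Factor₂-occurs l1 l0 _ = 9  , m≤m+n 10 11 , refl , refl
Factor₂-occurs l0 l0 _ = 20 , ≤-refl , refl , refl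

factorsBefore-2 : FactorsBefore gω 2 21
factorsBefore-2 i with Factor₂-occurs (gω i) (gω (suc i)) (Factor₂-gω i)
... | i′ , i′<21 , e₁ , e₂ = i′ , i′<21 , cong₂ (λ c d → c ∷ d ∷ []) (sym e₁) (sym e₂)

factor-double-cong : ∀ {p p′} L → 1 ≤ p → 1 ≤ p′ → factor gω p L ≡ factor gω p′ L →
                     factor gω (suc (double p)) (double L) ≡ factor gω (suc (double p′)) (double L)
factor-double-cong {p} {p′} L p≥1 p′≥1 e =
  trans (factor-double p L p≥1) (trans (cong g e) (sym (factor-double p′ L p′≥1)))

-- A factor at position 2p+1 or 2p+2 lies in the g-image of a factor at p, whose earlier occurrence
-- p′ is not 0 because a occurs only at position 0.
factorsBefore-step : ∀ {n L B} → suc n ≤ double L → FactorsBefore gω L B → FactorsBefore gω n (3 + double B)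
factorsBefore-step _ _ 0 = 0 , s≤s z≤n , refl
factorsBefore-step _ _ 1 = 1 , s≤s (s≤s z≤n) , refl
factorsBefore-step _ _ 2 = 2 , s≤s (s≤s (s≤s z≤n)) , refl
factorsBefore-step {n} {suc L} (s≤s n≤) cover (suc (suc (suc j))) with odd-or-even≥3 j
... | q , parity with cover (suc q) | parity
...   | zero , _ , e | _ = ⊥-elim (subst NotA (∷-injectiveˡ e) (gω-suc-NotA q))
...   | suc q′ , i′<B , e | inj₁ i≡odd = suc (double (suc q′)) ,
  ≤-trans (2+double-mono i′<B) (m≤n+m _ 3) ,
  subst (λ i → factor gω i n ≡ factor gω (suc (double (suc q′))) n) (sym i≡odd)
    (factor-prefix-≤ (m≤n⇒m≤1+n n≤) (factor-double-cong (suc L) (s≤s z≤n) (s≤s z≤n) e))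
...   | suc q′ , i′<B , e | inj₂ i≡even = 2 + double (suc q′) ,
  s≤s (≤-trans (2+double-mono i′<B) (m≤n+m _ 2)) ,
  subst (λ i → factor gω i n ≡ factor gω (2 + double (suc q′)) n) (sym i≡even)
    (factor-prefix-≤ n≤ (∷-injectiveʳ (factor-double-cong (suc L) (s≤s z≤n) (s≤s z≤n) e)))

halving : ∀ j → ∃ λ L → 4 + j ≤ double L × L < 3 + j
halving zero          = 2 , ≤-refl , ≤-refl
halving (suc zero)    = 3 , n≤1+n 5 , ≤-refl
halving (suc (suc j)) with halving j
... | L , le , lt = suc L , s≤s (s≤s le) , s≤s (m≤n⇒m≤1+n lt)

factorsBefore : ∀ n → ∃ λ B → FactorsBefore gω n B
factorsBefore = <-rec (λ n → ∃ λ B → FactorsBefore gω n B) step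
  where
  step : ∀ n → (∀ {m} → m < n → ∃ λ B → FactorsBefore gω m B) → ∃ λ B → FactorsBefore gω n B
  step 0 _ = 21 , FactorsBefore-≤ z≤n factorsBefore-2
  step 1 _ = 21 , FactorsBefore-≤ (s≤s z≤n) factorsBefore-2
  step 2 _ = 21 , factorsBefore-2
  step (suc (suc (suc j))) ih with halving j
  ... | L , le , lt with ih lt
  ... | B , cover = 3 + double B , factorsBefore-step le cover

-- Counting binomial classes

∀-Letter? : {Q : Letter → Set} → (∀ c → Dec (Q c)) → Dec (∀ c → Q c)
∀-Letter? Q? = map′ (λ { (qa , q0 , q1 , qα) → λ { a → qa ; l0 → q0 ; l1 → q1 ; α → qα } })
                    (λ q → q a , q l0 , q l1 , q α)
                    (Q? a ×-dec Q? l0 ×-dec Q? l1 ×-dec Q? α)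

∀-length≤? : {P : Word → Set} → (∀ w → Dec (P w)) → ∀ k → Dec (∀ w → length w ≤ k → P w)
∀-length≤? P? zero = map′ (λ { p [] _ → p }) (λ h → h [] z≤n) (P? [])
∀-length≤? P? (suc k) =
  map′ (λ { (p , _) [] _ → p ; (_ , q) (c ∷ w) (s≤s l) → q c w l })
       (λ h → h [] z≤n , λ c w l → h (c ∷ w) (s≤s l))
       (P? [] ×-dec ∀-Letter? (λ c → ∀-length≤? (λ w → P? (c ∷ w)) k))

_∼[_]?_ : ∀ u k v → Dec (u ∼[ k ] v)
u ∼[ k ]? v = ∀-length≤? (λ x → binom u x ≟ binom v x) k

∼-refl : ∀ {u k} → u ∼[ k ] u
∼-refl _ _ = refl

∼-sym : ∀ {u v k} → u ∼[ k ] v → v ∼[ k ] u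
∼-sym h x l = sym (h x l)

∼-trans : ∀ {u v w k} → u ∼[ k ] v → v ∼[ k ] w → u ∼[ k ] w
∼-trans h h′ x l = trans (h x l) (h′ x l)

∼-pred : ∀ {u v k} → u ∼[ suc k ] v → u ∼[ k ] v
∼-pred h x l = h x (m≤n⇒m≤1+n l)

module ClassCount (x : ℕ → Letter) (k n : ℕ) where

  _≈_ : ℕ → ℕ → Set
  i ≈ j = factor x i n ∼[ k ] factor x j n

  Classes : ℕ → Set
  Classes B = ∃ λ m → Σ (Fin m → ℕ) λ pos →
    ((p q : Fin m) → pos p ≈ pos q → p ≡ q) × (∀ j → j < B → ∃ λ p → j ≈ pos p)

  classes : ∀ B → Classes B
  classes zero = 0 , (λ ()) , (λ ()) , (λ _ ())
  classes (suc B) with classes B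
  ... | m , pos , distinct , cover with any? (λ p → factor x B n ∼[ k ]? factor x (pos p) n)
  ... | yes (p , B≈p) = m , pos , distinct , cover′
    where
    cover′ : ∀ j → j < suc B → ∃ λ p → j ≈ pos p
    cover′ j (s≤s j≤B) with m≤n⇒m<n∨m≡n j≤B
    ... | inj₁ j<B  = cover j j<B
    ... | inj₂ refl = p , B≈p
  ... | no B≉ = suc m , pos′ , distinct′ , cover′
    where
    pos′ : Fin (suc m) → ℕ
    pos′ Fin.zero    = B
    pos′ (Fin.suc p) = pos p
    distinct′ : (p q : Fin (suc m)) → pos′ p ≈ pos′ q → p ≡ q
    distinct′ Fin.zero    Fin.zero    _ = refl
    distinct′ Fin.zero    (Fin.suc q) h = ⊥-elim (B≉ (q , h))
    distinct′ (Fin.suc p) Fin.zero    h = ⊥-elim (B≉ (p , ∼-sym h))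
    distinct′ (Fin.suc p) (Fin.suc q) h = cong Fin.suc (distinct p q h)
    cover′ : ∀ j → j < suc B → ∃ λ p → j ≈ pos′ p
    cover′ j (s≤s j≤B) with m≤n⇒m<n∨m≡n j≤B
    ... | inj₁ j<B  = let (p , j≈p) = cover j j<B in Fin.suc p , j≈p
    ... | inj₂ refl = Fin.zero , ∼-refl

  hasClassCount : ∀ {B} → FactorsBefore x n B → ∃ (HasClassCount x k n)
  hasClassCount {B} before with classes B
  ... | m , pos , distinct , cover = m , pos , distinct , λ i →
    let (i′ , i′<B , e) = before i ; (p , i′≈p) = cover i′ i′<B in
    p , subst (_∼[ k ] factor x (pos p) n) (sym e) i′≈p

  ≤-classCount : ∀ {m c} → HasClassCount x k n m → (ps : Fin c → ℕ) →
                 (∀ p q → p ≢ q → ¬ ps p ≈ ps q) → c ≤ m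
  ≤-classCount {m} {c} (pos , _ , cover) ps separated = ≮⇒≥ c≮m
    where
    c≮m : ¬ m < c
    c≮m m<c with pigeonhole m<c (λ p → proj₁ (cover (ps p)))
    ... | p , q , p<q , same = separated p q (<⇒≢ᶠ p<q)
      (∼-trans (proj₂ (cover (ps p))) (subst (λ r → pos r ≈ ps q) (sym same) (∼-sym (proj₂ (cover (ps q))))))

-- The k-classes stay pairwise (k+1)-separated, and one of i, j is (k+1)-separated from its k-representative.
classCount-< : ∀ (x : ℕ → Letter) k n {m m′} → HasClassCount x k n m → HasClassCount x (suc k) n m′ →
               ∀ i j → factor x i n ∼[ k ] factor x j n → ¬ factor x i n ∼[ suc k ] factor x j n → m < m′
classCount-< x k n {m} (pos , distinct , cover) count′ i j i∼j i≁j =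
  ClassCount.≤-classCount x (suc k) n count′ ps separated
  where
  F : ℕ → Word
  F l = factor x l n
  p₀ = proj₁ (cover i)
  split : ∃ λ t → F t ∼[ k ] F (pos p₀) × ¬ F t ∼[ suc k ] F (pos p₀)
  split with F i ∼[ suc k ]? F (pos p₀)
  ... | no i≁p₀  = i , proj₂ (cover i) , i≁p₀
  ... | yes i∼p₀ = j , ∼-trans (∼-sym i∼j) (proj₂ (cover i)) , λ j∼p₀ → i≁j (∼-trans i∼p₀ (∼-sym j∼p₀))
  t = proj₁ split
  ps : Fin (suc m) → ℕ
  ps Fin.zero    = t
  ps (Fin.suc p) = pos p
  t-separated : ∀ q → ¬ F t ∼[ suc k ] F (pos q)
  t-separated q h with distinct q p₀ (∼-trans (∼-sym (∼-pred h)) (proj₁ (proj₂ split)))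
  ... | refl = proj₂ (proj₂ split) h
  separated : ∀ p q → p ≢ q → ¬ F (ps p) ∼[ suc k ] F (ps q)
  separated Fin.zero    Fin.zero    p≢q _ = p≢q refl
  separated Fin.zero    (Fin.suc q) _   h = t-separated q h
  separated (Fin.suc p) Fin.zero    _   h = t-separated p (∼-sym h)
  separated (Fin.suc p) (Fin.suc q) p≢q h = p≢q (cong Fin.suc (distinct p q (∼-pred h)))

-- Binomial coefficients of a concatenation

-- splitSum f h w = Σ_{u v = w} f u · h v, and splitSum⁺ omits the split with v = [].
splitSum : (Word → ℕ) → (Word → ℕ) → Word → ℕ
splitSum f h []      = f [] * h []
splitSum f h (d ∷ w) = f [] * h (d ∷ w) + splitSum (λ u → f (d ∷ u)) h w

splitSum⁺ : (Word → ℕ) → (Word → ℕ) → Word → ℕ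
splitSum⁺ f h []      = 0
splitSum⁺ f h (d ∷ w) = f [] * h (d ∷ w) + splitSum⁺ (λ u → f (d ∷ u)) h w

splitSum≡splitSum⁺+last : ∀ f h w → splitSum f h w ≡ splitSum⁺ f h w + f w * h []
splitSum≡splitSum⁺+last f h []      = refl
splitSum≡splitSum⁺+last f h (d ∷ w) =
  trans (cong (f [] * h (d ∷ w) +_) (splitSum≡splitSum⁺+last (λ u → f (d ∷ u)) h w))
        (sym (+-assoc (f [] * h (d ∷ w)) _ _))

splitSum-cong : ∀ {f₁ f₂ h₁ h₂} w → (∀ u → length u ≤ length w → f₁ u ≡ f₂ u) →
                (∀ v → length v ≤ length w → h₁ v ≡ h₂ v) → splitSum f₁ h₁ w ≡ splitSum f₂ h₂ w
splitSum-cong []      ef eh = cong₂ _*_ (ef [] z≤n) (eh [] z≤n)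
splitSum-cong (d ∷ w) ef eh = cong₂ _+_ (cong₂ _*_ (ef [] z≤n) (eh (d ∷ w) ≤-refl))
  (splitSum-cong w (λ u l → ef (d ∷ u) (s≤s l)) (λ v l → eh v (m≤n⇒m≤1+n l)))

splitSum⁺-cong : ∀ {f₁ f₂ h₁ h₂} w → (∀ u → length u < length w → f₁ u ≡ f₂ u) →
                 (∀ v → length v ≤ length w → h₁ v ≡ h₂ v) → splitSum⁺ f₁ h₁ w ≡ splitSum⁺ f₂ h₂ w
splitSum⁺-cong []      ef eh = refl
splitSum⁺-cong (d ∷ w) ef eh = cong₂ _+_ (cong₂ _*_ (ef [] (s≤s z≤n)) (eh (d ∷ w) ≤-refl))
  (splitSum⁺-cong w (λ u l → ef (d ∷ u) (s≤s l)) (λ v l → eh v (m≤n⇒m≤1+n l)))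

splitSum-+ˡ : ∀ f₁ f₂ h w → splitSum (λ u → f₁ u + f₂ u) h w ≡ splitSum f₁ h w + splitSum f₂ h w
splitSum-+ˡ f₁ f₂ h []      = *-distribʳ-+ (h []) (f₁ []) (f₂ [])
splitSum-+ˡ f₁ f₂ h (d ∷ w) =
  trans (cong₂ _+_ (*-distribʳ-+ (h (d ∷ w)) (f₁ []) (f₂ [])) (splitSum-+ˡ _ _ h w))
        (+-+-comm (f₁ [] * h (d ∷ w)) _ _ _)
  where
  +-+-comm : ∀ p q r s → (p + q) + (r + s) ≡ (p + r) + (q + s)
  +-+-comm = solve 4 (λ p q r s → (p :+ q) :+ (r :+ s) := (p :+ r) :+ (q :+ s)) refl
    where open +-*-Solver

splitSum-binom-[] : ∀ h w → splitSum (binom []) h w ≡ h w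
splitSum-binom-[] h []      = +-identityʳ (h [])
splitSum-binom-[] h (d ∷ w) = trans (cong₂ _+_ (+-identityʳ (h (d ∷ w))) (splitSum-0 w)) (+-identityʳ _)
  where
  splitSum-0 : ∀ w → splitSum (λ _ → 0) h w ≡ 0
  splitSum-0 []      = refl
  splitSum-0 (_ ∷ w) = splitSum-0 w

binom-∷-≡ : ∀ {c d} u w → c ≡ d → binom (c ∷ u) (d ∷ w) ≡ binom u (d ∷ w) + binom u w
binom-∷-≡ {c} {d} u w c≡d with c ≟L d
... | yes _  = refl
... | no c≢d = ⊥-elim (c≢d c≡d)

binom-∷-≢ : ∀ {c d} u w → c ≢ d → binom (c ∷ u) (d ∷ w) ≡ binom u (d ∷ w)
binom-∷-≢ {c} {d} u w c≢d with c ≟L d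
... | yes c≡d = ⊥-elim (c≢d c≡d)
... | no _    = refl

binom-++ : ∀ x y w → binom (x ++ y) w ≡ splitSum (binom x) (binom y) w
binom-++ []      y w       = sym (splitSum-binom-[] (binom y) w)
binom-++ (c ∷ x) y []      = refl
binom-++ (c ∷ x) y (d ∷ w) = by-cases (c ≟L d)
  where
  open ≡-Reasoning
  P : Word → ℕ
  P u = binom (c ∷ x) (d ∷ u)
  by-cases : Dec (c ≡ d) → binom (c ∷ x ++ y) (d ∷ w) ≡ splitSum (binom (c ∷ x)) (binom y) (d ∷ w)
  by-cases (no c≢d) = begin
    binom (c ∷ x ++ y) (d ∷ w)
      ≡⟨ binom-∷-≢ (x ++ y) w c≢d ⟩
    binom (x ++ y) (d ∷ w)
      ≡⟨ binom-++ x y (d ∷ w) ⟩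
    binom y (d ∷ w) + 0 + splitSum (λ u → binom x (d ∷ u)) (binom y) w
      ≡⟨ cong (binom y (d ∷ w) + 0 +_) (splitSum-cong w (λ u _ → sym (binom-∷-≢ x u c≢d)) (λ _ _ → refl)) ⟩
    binom y (d ∷ w) + 0 + splitSum P (binom y) w ∎
  by-cases (yes c≡d) = begin
    binom (c ∷ x ++ y) (d ∷ w)
      ≡⟨ binom-∷-≡ (x ++ y) w c≡d ⟩
    binom (x ++ y) (d ∷ w) + binom (x ++ y) w
      ≡⟨ cong₂ _+_ (binom-++ x y (d ∷ w)) (binom-++ x y w) ⟩
    (binom y (d ∷ w) + 0 + splitSum (λ u → binom x (d ∷ u)) (binom y) w) + splitSum (binom x) (binom y) w
      ≡⟨ +-assoc (binom y (d ∷ w) + 0) _ _ ⟩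
    binom y (d ∷ w) + 0 + (splitSum (λ u → binom x (d ∷ u)) (binom y) w + splitSum (binom x) (binom y) w)
      ≡⟨ cong (binom y (d ∷ w) + 0 +_) (sym (splitSum-+ˡ _ (binom x) (binom y) w)) ⟩
    binom y (d ∷ w) + 0 + splitSum (λ u → binom x (d ∷ u) + binom x u) (binom y) w
      ≡⟨ cong (binom y (d ∷ w) + 0 +_) (splitSum-cong w (λ u _ → sym (binom-∷-≡ x u c≡d)) (λ _ _ → refl)) ⟩
    binom y (d ∷ w) + 0 + splitSum P (binom y) w ∎

∼-++ʳ : ∀ {u v k} z → u ∼[ k ] v → (u ++ z) ∼[ k ] (v ++ z)
∼-++ʳ {u} {v} z u∼v x l = begin
  binom (u ++ z) x                  ≡⟨ binom-++ u z x ⟩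
  splitSum (binom u) (binom z) x    ≡⟨ splitSum-cong x (λ y l′ → u∼v y (≤-trans l′ l)) (λ _ _ → refl) ⟩
  splitSum (binom v) (binom z) x    ≡⟨ binom-++ v z x ⟨
  binom (v ++ z) x                  ∎
  where open ≡-Reasoning

binom-++-∷ : ∀ x y d w → binom (x ++ y) (d ∷ w) ≡
             binom y (d ∷ w) + 0 + (splitSum⁺ (λ u → binom x (d ∷ u)) (binom y) w + binom x (d ∷ w) * 1)
binom-++-∷ x y d w = trans (binom-++ x y (d ∷ w)) (cong (binom y (d ∷ w) + 0 +_) (splitSum≡splitSum⁺+last _ (binom y) w))

-- The two extreme splits of d ∷ w exchange roles; all other splits have both parts of length ≤ k.
++-comm-∼ : ∀ {u v k} → u ∼[ k ] v → (u ++ v) ∼[ suc k ] (v ++ u)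
++-comm-∼ {u} {v} u∼v []      _       = refl
++-comm-∼ {u} {v} u∼v (d ∷ w) (s≤s l) = begin
  binom (u ++ v) (d ∷ w)
    ≡⟨ binom-++-∷ u v d w ⟩
  B (d ∷ w) + 0 + (splitSum⁺ (λ x → A (d ∷ x)) B w + A (d ∷ w) * 1)
    ≡⟨ cong (λ s → B (d ∷ w) + 0 + (s + A (d ∷ w) * 1))
         (splitSum⁺-cong w (λ x l′ → u∼v (d ∷ x) (≤-trans l′ l)) (λ x l′ → sym (u∼v x (≤-trans l′ l)))) ⟩
  B (d ∷ w) + 0 + (splitSum⁺ (λ x → B (d ∷ x)) A w + A (d ∷ w) * 1)
    ≡⟨ exchange (B (d ∷ w)) _ (A (d ∷ w)) ⟩
  A (d ∷ w) + 0 + (splitSum⁺ (λ x → B (d ∷ x)) A w + B (d ∷ w) * 1)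
    ≡⟨ binom-++-∷ v u d w ⟨
  binom (v ++ u) (d ∷ w) ∎
  where
  open ≡-Reasoning
  A = binom u
  B = binom v
  exchange : ∀ p s q → p + 0 + (s + q * 1) ≡ q + 0 + (s + p * 1)
  exchange = solve 3 (λ p s q → p :+ con 0 :+ (s :+ q :* con 1) := q :+ con 0 :+ (s :+ p :* con 1)) refl
    where open +-*-Solver

-- Thue–Morse blocks

IsBit : Letter → Set
IsBit l0 = ⊤
IsBit l1 = ⊤
IsBit _  = ⊥

complW : Word → Word
complW = map compl

compl-involutive : ∀ c → compl (compl c) ≡ c
compl-involutive a  = refl
compl-involutive l0 = refl
compl-involutive l1 = refl
compl-involutive α  = refl

complW-involutive : ∀ w → complW (complW w) ≡ w
complW-involutive w = trans (sym (map-∘ w)) (trans (map-cong compl-involutive w) (map-id w))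

All-IsBit-g : ∀ {w} → All IsBit w → All IsBit (g w)
All-IsBit-g {[]}     []      = []
All-IsBit-g {l0 ∷ w} (_ ∷ h) = tt ∷ tt ∷ All-IsBit-g h
All-IsBit-g {l1 ∷ w} (_ ∷ h) = tt ∷ tt ∷ All-IsBit-g h

g-complW : ∀ {w} → All IsBit w → g (complW w) ≡ complW (g w)
g-complW {[]}     []      = refl
g-complW {l0 ∷ w} (_ ∷ h) = cong (λ z → l1 ∷ l0 ∷ z) (g-complW h)
g-complW {l1 ∷ w} (_ ∷ h) = cong (λ z → l0 ∷ l1 ∷ z) (g-complW h)

-- On {0, 1} the morphism g is the Thue–Morse morphism φ, so thueMorse k = φ^k(0).
thueMorse : ℕ → Word
thueMorse zero    = l0 ∷ []
thueMorse (suc k) = g (thueMorse k)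

All-IsBit-thueMorse : ∀ k → All IsBit (thueMorse k)
All-IsBit-thueMorse zero    = tt ∷ []
All-IsBit-thueMorse (suc k) = All-IsBit-g (All-IsBit-thueMorse k)

thueMorse-suc : ∀ k → thueMorse (suc k) ≡ thueMorse k ++ complW (thueMorse k)
thueMorse-suc zero    = refl
thueMorse-suc (suc k) = begin
  g (g (thueMorse k))                                  ≡⟨ cong g (thueMorse-suc k) ⟩
  g (thueMorse k ++ complW (thueMorse k))              ≡⟨ g-++ (thueMorse k) _ ⟩
  g (thueMorse k) ++ g (complW (thueMorse k))          ≡⟨ cong (g (thueMorse k) ++_) (g-complW (All-IsBit-thueMorse k)) ⟩
  g (thueMorse k) ++ complW (g (thueMorse k))          ∎
  where open ≡-Reasoning

complW-thueMorse-suc : ∀ k → complW (thueMorse (suc k)) ≡ complW (thueMorse k) ++ thueMorse k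
complW-thueMorse-suc k = begin
  complW (thueMorse (suc k))                            ≡⟨ cong complW (thueMorse-suc k) ⟩
  complW (thueMorse k ++ complW (thueMorse k))          ≡⟨ map-++ compl (thueMorse k) _ ⟩
  complW (thueMorse k) ++ complW (complW (thueMorse k)) ≡⟨ cong (complW (thueMorse k) ++_) (complW-involutive _) ⟩
  complW (thueMorse k) ++ thueMorse k                   ∎
  where open ≡-Reasoning

thueMorse-∼-complW : ∀ k → thueMorse k ∼[ k ] complW (thueMorse k)
thueMorse-∼-complW zero    []       _ = refl
thueMorse-∼-complW (suc k) x l = begin
  binom (thueMorse (suc k)) x                          ≡⟨ cong (λ u → binom u x) (thueMorse-suc k) ⟩
  binom (thueMorse k ++ complW (thueMorse k)) x        ≡⟨ ++-comm-∼ (thueMorse-∼-complW k) x l ⟩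
  binom (complW (thueMorse k) ++ thueMorse k) x        ≡⟨ cong (λ u → binom u x) (complW-thueMorse-suc k) ⟨
  binom (complW (thueMorse (suc k))) x                 ∎
  where open ≡-Reasoning

ones : ℕ → Word
ones j = replicate j l1

binom-ones : ∀ u j → binom u (ones j) ≡ binom u (l1 ∷ []) C j
binom-ones []      zero    = refl
binom-ones []      (suc j) = refl
binom-ones (c ∷ u) zero    = refl
binom-ones (c ∷ u) (suc j) with c ≟L l1
... | no  _ = binom-ones u (suc j)
... | yes _ = begin
  binom u (ones (suc j)) + binom u (ones j)                  ≡⟨ cong₂ _+_ (binom-ones u (suc j)) (binom-ones u j) ⟩
  binom u (l1 ∷ []) C suc j + binom u (l1 ∷ []) C j          ≡⟨ +-comm _ (binom u (l1 ∷ []) C j) ⟩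
  binom u (l1 ∷ []) C j + binom u (l1 ∷ []) C suc j          ≡⟨ nCk+nC[k+1]≡[n+1]C[k+1] (binom u (l1 ∷ [])) j ⟩
  suc (binom u (l1 ∷ [])) C suc j                            ≡⟨ cong (_C suc j) (+-comm 1 (binom u (l1 ∷ []))) ⟩
  (binom u (l1 ∷ []) + 1) C suc j                            ∎
  where open ≡-Reasoning

thueMorse-ones : ∀ k → 1 ≤ k → ∀ j → binom (thueMorse k) (ones j) ≡ binom (complW (thueMorse k)) (ones j)
thueMorse-ones k k≥1 j = begin
  binom (thueMorse k) (ones j)                       ≡⟨ binom-ones (thueMorse k) j ⟩
  binom (thueMorse k) (l1 ∷ []) C j                  ≡⟨ cong (_C j) (thueMorse-∼-complW k (l1 ∷ []) k≥1) ⟩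
  binom (complW (thueMorse k)) (l1 ∷ []) C j         ≡⟨ binom-ones (complW (thueMorse k)) j ⟨
  binom (complW (thueMorse k)) (ones j)              ∎
  where open ≡-Reasoning

thueMorse-head : ∀ k → ∃ λ r → thueMorse k ≡ l0 ∷ r
thueMorse-head zero    = [] , refl
thueMorse-head (suc k) with thueMorse-head k
... | r , e = l1 ∷ g r , cong g e

complW-thueMorse-has-1 : ∀ k → 0 < binom (complW (thueMorse k)) (l1 ∷ [])
complW-thueMorse-has-1 k with thueMorse-head k
... | r , e rewrite e = subst (0 <_) (+-comm 1 _) (s≤s z≤n)

splitSum⁺-ones-< : ∀ m {f₁ f₂ h₁ h₂} → (∀ i → i < m → f₂ (ones i) ≤ f₁ (ones i)) → f₂ (ones m) < f₁ (ones m) →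
                   (∀ j → h₂ (ones j) ≡ h₁ (ones j)) → 0 < h₁ (ones 1) →
                   splitSum⁺ f₂ h₂ (ones (suc m)) < splitSum⁺ f₁ h₁ (ones (suc m))
splitSum⁺-ones-< zero {f₁} {f₂} {h₁} {h₂} _ f< h≡ h>0 =
  subst (λ n → f₂ [] * n + 0 < f₁ [] * h₁ (ones 1) + 0) (sym (h≡ 1))
        (+-monoˡ-< 0 (*-monoˡ-< (h₁ (ones 1)) {{>-nonZero h>0}} f<))
splitSum⁺-ones-< (suc m) {f₁} {f₂} f≤ f< h≡ h>0 =
  +-mono-≤-< (*-mono-≤ (f≤ 0 (s≤s z≤n)) (≤-reflexive (h≡ (2 + m))))
             (splitSum⁺-ones-< m {λ x → f₁ (l1 ∷ x)} {λ x → f₂ (l1 ∷ x)} (λ i l → f≤ (suc i) (s≤s l)) f< h≡ h>0)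

-- Expanding both sides over the splits of 0 1^(k+1), all terms cancel except the split 0 1^k · 1.
thueMorse-separated : ∀ k → 1 ≤ k →
  binom (complW (thueMorse k)) (l0 ∷ ones k) < binom (thueMorse k) (l0 ∷ ones k)
thueMorse-separated (suc zero)    _ = s≤s z≤n
thueMorse-separated (suc (suc k)) _ = begin-strict
  binom (complW (thueMorse (suc k′))) w
    ≡⟨ cong (λ u → binom u w) (complW-thueMorse-suc k′) ⟩
  binom (complW (thueMorse k′) ++ thueMorse k′) w
    ≡⟨ binom-++-∷ (complW (thueMorse k′)) (thueMorse k′) l0 (ones (suc k′)) ⟩
  A w + 0 + (splitSum⁺ (λ x → B (l0 ∷ x)) A (ones (suc k′)) + B w * 1)
    <⟨ combine (A w) (B w) (middle< (thueMorse-separated (suc k) (s≤s z≤n))) ⟩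
  B w + 0 + (splitSum⁺ (λ x → A (l0 ∷ x)) B (ones (suc k′)) + A w * 1)
    ≡⟨ binom-++-∷ (thueMorse k′) (complW (thueMorse k′)) l0 (ones (suc k′)) ⟨
  binom (thueMorse k′ ++ complW (thueMorse k′)) w
    ≡⟨ cong (λ u → binom u w) (thueMorse-suc k′) ⟨
  binom (thueMorse (suc k′)) w ∎
  where
  open ≤-Reasoning
  k′ : ℕ
  k′ = suc k
  A = binom (thueMorse k′)
  B = binom (complW (thueMorse k′))
  w = l0 ∷ ones (suc k′)
  middle< : B (l0 ∷ ones k′) < A (l0 ∷ ones k′) →
            splitSum⁺ (λ x → B (l0 ∷ x)) A (ones (suc k′)) < splitSum⁺ (λ x → A (l0 ∷ x)) B (ones (suc k′))
  middle< ih = splitSum⁺-ones-< k′ {λ x → A (l0 ∷ x)} {λ x → B (l0 ∷ x)} {B} {A}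
    (λ i i<k′ → ≤-reflexive (sym (thueMorse-∼-complW k′ (l0 ∷ ones i) (subst (λ n → suc n ≤ k′) (sym (length-replicate i)) i<k′))))
    ih (thueMorse-ones k′ (s≤s z≤n)) (complW-thueMorse-has-1 k′)
  combine : ∀ p q {s t} → s < t → p + 0 + (s + q * 1) < q + 0 + (t + p * 1)
  combine p q {s} {t} s<t = subst₂ _<_ (normalise p q s) (trans (cong (_+ t) (+-comm p q)) (normalise q p t))
    (+-monoʳ-< (p + q) s<t)
    where
    normalise : ∀ p q s → p + q + s ≡ p + 0 + (s + q * 1)
    normalise = solve 3 (λ p q s → p :+ q :+ s := p :+ con 0 :+ (s :+ q :* con 1)) refl
      where open +-*-Solver

-- Thue–Morse blocks followed by α-runs in gω

pow2 : ℕ → ℕ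
pow2 zero    = 1
pow2 (suc j) = double (pow2 j)

n<pow2 : ∀ n → n < pow2 n
n<pow2 zero    = s≤s z≤n
n<pow2 (suc n) with pow2 n | n<pow2 n
... | suc p | s≤s n≤p = s≤s (≤-trans (s≤s n≤p) (s≤s (n≤double p)))

-- The block thueMorse j of gω starts at position 2^(j+1) − 1.
blockStart : ℕ → ℕ
blockStart zero    = 1
blockStart (suc j) = suc (double (blockStart j))

1≤blockStart : ∀ j → 1 ≤ blockStart j
1≤blockStart zero    = s≤s z≤n
1≤blockStart (suc j) = s≤s z≤n

thueMorse-occurs : ∀ j → factor gω (blockStart j) (pow2 j) ≡ thueMorse j
thueMorse-occurs zero    = refl
thueMorse-occurs (suc j) = trans (factor-double (blockStart j) (pow2 j) (1≤blockStart j)) (cong g (thueMorse-occurs j))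

double-+ : ∀ m n → double m + suc (double n) ≡ suc (double (m + n))
double-+ zero    n = refl
double-+ (suc m) n = cong (2 +_) (double-+ m n)

g-replicate-α : ∀ m → g (replicate m α) ≡ replicate (double m) α
g-replicate-α zero    = refl
g-replicate-α (suc m) = cong (λ w → α ∷ α ∷ w) (g-replicate-α m)

α-run-occurs : ∀ j → factor gω (pow2 j + blockStart j) (pow2 j) ≡ replicate (pow2 j) α
α-run-occurs zero    = refl
α-run-occurs (suc j) = begin
  factor gω (double (pow2 j) + suc (double (blockStart j))) (double (pow2 j))
    ≡⟨ cong (λ i → factor gω i (double (pow2 j))) (double-+ (pow2 j) (blockStart j)) ⟩
  factor gω (suc (double (pow2 j + blockStart j))) (double (pow2 j))
    ≡⟨ factor-double (pow2 j + blockStart j) (pow2 j) (≤-trans (1≤blockStart j) (m≤n+m _ (pow2 j))) ⟩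
  g (factor gω (pow2 j + blockStart j) (pow2 j))
    ≡⟨ cong g (α-run-occurs j) ⟩
  g (replicate (pow2 j) α)
    ≡⟨ g-replicate-α (pow2 j) ⟩
  replicate (double (pow2 j)) α ∎
  where open ≡-Reasoning

replicate-+ : ∀ m n (c : Letter) → replicate (m + n) c ≡ replicate m c ++ replicate n c
replicate-+ zero    n c = refl
replicate-+ (suc m) n c = cong (c ∷_) (replicate-+ m n c)

α-run-prefix-occurs : ∀ {j M} → M ≤ pow2 j → factor gω (pow2 j + blockStart j) M ≡ replicate M α
α-run-prefix-occurs {j} {M} M≤ = proj₁ (factor-++⁻ gω _ (length-replicate M) (begin
  factor gω (pow2 j + blockStart j) (M + (pow2 j ∸ M))   ≡⟨ cong (factor gω _) (m+[n∸m]≡n M≤) ⟩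
  factor gω (pow2 j + blockStart j) (pow2 j)             ≡⟨ α-run-occurs j ⟩
  replicate (pow2 j) α                                   ≡⟨ cong (λ n → replicate n α) (m+[n∸m]≡n M≤) ⟨
  replicate (M + (pow2 j ∸ M)) α                         ≡⟨ replicate-+ M (pow2 j ∸ M) α ⟩
  replicate M α ++ replicate (pow2 j ∸ M) α              ∎))
  where open ≡-Reasoning

length-thueMorse : ∀ j → length (thueMorse j) ≡ pow2 j
length-thueMorse j = trans (cong length (sym (thueMorse-occurs j))) (length-factor gω (blockStart j) (pow2 j))

EndsWith : Word → Word → Set
EndsWith w s = ∃ λ X → w ≡ X ++ s

suffix-α-run-occurs : ∀ j {Y} M → EndsWith (thueMorse j) Y → M ≤ pow2 j →
                      ∃ λ i → factor gω i (length Y + M) ≡ Y ++ replicate M α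
suffix-α-run-occurs j {Y} M (X , TM≡XY) M≤ = length X + blockStart j , (begin
  factor gω i (length Y + M)                                  ≡⟨ factor-++ gω i (length Y) M ⟩
  factor gω i (length Y) ++ factor gω (length Y + i) M        ≡⟨ cong₂ _++_ Y-occurs (cong (λ i′ → factor gω i′ M) run-start) ⟩
  Y ++ factor gω (pow2 j + blockStart j) M                    ≡⟨ cong (Y ++_) (α-run-prefix-occurs {j} M≤) ⟩
  Y ++ replicate M α                                          ∎)
  where
  open ≡-Reasoning
  i = length X + blockStart j
  |X|+|Y| : length X + length Y ≡ pow2 j
  |X|+|Y| = trans (sym (length-++ X)) (trans (cong length (sym TM≡XY)) (length-thueMorse j))
  Y-occurs : factor gω i (length Y) ≡ Y
  Y-occurs = proj₂ (factor-++⁻ gω (blockStart j) refl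
    (trans (cong (factor gω (blockStart j)) |X|+|Y|) (trans (thueMorse-occurs j) TM≡XY)))
  run-start : length Y + i ≡ pow2 j + blockStart j
  run-start = trans (sym (+-assoc (length Y) (length X) _)) (cong (_+ blockStart j) (trans (+-comm (length Y) _) |X|+|Y|))

EndsWith-trans : ∀ {u v w} → EndsWith u v → EndsWith v w → EndsWith u w
EndsWith-trans {w = w} (X , u≡Xv) (Y , v≡Yw) = X ++ Y , trans u≡Xv (trans (cong (X ++_) v≡Yw) (sym (++-assoc X Y w)))

thueMorse-endsWith : ∀ d m → EndsWith (thueMorse (double d + m)) (thueMorse m)
thueMorse-endsWith zero    m = [] , refl
thueMorse-endsWith (suc d) m = EndsWith-trans
  (thueMorse (suc (double d + m)) , thueMorse-suc (suc (double d + m)))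
  (EndsWith-trans (complW (thueMorse (double d + m)) , complW-thueMorse-suc (double d + m)) (thueMorse-endsWith d m))

IsBit⇒≢α : ∀ {c} → IsBit c → c ≢ α
IsBit⇒≢α {l0} _ ()
IsBit⇒≢α {l1} _ ()

binom-α-run : ∀ N {d} w → IsBit d → binom (replicate N α) (d ∷ w) ≡ 0
binom-α-run zero    w _     = refl
binom-α-run (suc N) w d-bit = trans (binom-∷-≢ _ w (λ α≡d → IsBit⇒≢α d-bit (sym α≡d))) (binom-α-run N w d-bit)

binom-++-α-run : ∀ X N {w} → All IsBit w → binom (X ++ replicate N α) w ≡ binom X w
binom-++-α-run X       N {[]}    _ = refl
binom-++-α-run []      N {d ∷ w} (d-bit ∷ _) = binom-α-run N w d-bit
binom-++-α-run (c ∷ X) N {d ∷ w} (d-bit ∷ w-bits) = by-cases (c ≟L d)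
  where
  by-cases : Dec (c ≡ d) → binom (c ∷ X ++ replicate N α) (d ∷ w) ≡ binom (c ∷ X) (d ∷ w)
  by-cases (yes c≡d) = trans (binom-∷-≡ _ w c≡d)
    (trans (cong₂ _+_ (binom-++-α-run X N (d-bit ∷ w-bits)) (binom-++-α-run X N w-bits)) (sym (binom-∷-≡ X w c≡d)))
  by-cases (no c≢d) = trans (binom-∷-≢ _ w c≢d)
    (trans (binom-++-α-run X N (d-bit ∷ w-bits)) (sym (binom-∷-≢ X w c≢d)))

binom-bits-++-α-run : ∀ {Y} N → All IsBit Y → binom (Y ++ replicate N α) (α ∷ []) ≡ N
binom-bits-++-α-run {[]}    zero    _ = refl
binom-bits-++-α-run {[]}    (suc N) _ = trans (cong (_+ 1) (binom-bits-++-α-run N [])) (+-comm N 1)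
binom-bits-++-α-run {c ∷ Y} N (c-bit ∷ bits) = trans (binom-∷-≢ _ [] (IsBit⇒≢α c-bit)) (binom-bits-++-α-run N bits)

≤pow2-double+ : ∀ N k → N ≤ pow2 (double N + k)
≤pow2-double+ N k = ≤-trans (≤-trans (n≤double N) (m≤m+n _ k)) (<⇒≤ (n<pow2 _))

thueMorse-α-run-occurs : ∀ k N → ∃ λ i → factor gω i (pow2 k + N) ≡ thueMorse k ++ replicate N α
thueMorse-α-run-occurs k N with suffix-α-run-occurs (double N + k) N (thueMorse-endsWith N k) (≤pow2-double+ N k)
... | i , e = i , subst (λ l → factor gω i (l + N) ≡ thueMorse k ++ replicate N α) (length-thueMorse k) e

complW-thueMorse-α-run-occurs : ∀ k N → ∃ λ i → factor gω i (pow2 k + N) ≡ complW (thueMorse k) ++ replicate N α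
complW-thueMorse-α-run-occurs k N
  with suffix-α-run-occurs (double N + suc k) N (EndsWith-trans (thueMorse-endsWith N (suc k)) (thueMorse k , thueMorse-suc k))
                             (≤pow2-double+ N (suc k))
... | i , e = i , subst (λ l → factor gω i (l + N) ≡ complW (thueMorse k) ++ replicate N α) (trans (length-map compl (thueMorse k)) (length-thueMorse k)) e

α-run-separated : ∀ {k} N → 1 ≤ k →
  ¬ (thueMorse k ++ replicate N α) ∼[ suc k ] (complW (thueMorse k) ++ replicate N α)
α-run-separated {k} N k≥1 h = <⇒≢ (thueMorse-separated k k≥1) (begin
  binom (complW (thueMorse k)) w                       ≡⟨ binom-++-α-run (complW (thueMorse k)) N w-bits ⟨
  binom (complW (thueMorse k) ++ replicate N α) w      ≡⟨ h w (s≤s (≤-reflexive (length-replicate k))) ⟨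
  binom (thueMorse k ++ replicate N α) w               ≡⟨ binom-++-α-run (thueMorse k) N w-bits ⟩
  binom (thueMorse k) w                                ∎)
  where
  open ≡-Reasoning
  w = l0 ∷ ones k
  w-bits : All IsBit w
  w-bits = tt ∷ replicate⁺ k tt

gω-hasClassCount : ∀ k n → ∃ (HasClassCount gω k n)
gω-hasClassCount k n = ClassCount.hasClassCount gω k n (proj₂ (factorsBefore n))

b-strictly-increases : ∀ k → 1 ≤ k → Prec gω k (suc k)
b-strictly-increases k k≥1 N
  with gω-hasClassCount k (pow2 k + N) | gω-hasClassCount (suc k) (pow2 k + N)
     | thueMorse-α-run-occurs k N | complW-thueMorse-α-run-occurs k N
... | m , count | m′ , count′ | iu , u-occurs | iv , v-occurs =
  pow2 k + N , m≤n+m N (pow2 k) , m , m′ , count , count′ ,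
  classCount-< gω k (pow2 k + N) count count′ iu iv
    (subst₂ _∼[ k ]_ (sym u-occurs) (sym v-occurs) (∼-++ʳ _ (thueMorse-∼-complW k)))
    (subst₂ (λ u v → ¬ u ∼[ suc k ] v) (sym u-occurs) (sym v-occurs) (α-run-separated N k≥1))

α-count-occurs : ∀ {B} t → t ≤ B → ∃ λ i → binom (factor gω i B) (α ∷ []) ≡ t
α-count-occurs {B} t t≤B = i , (begin
  binom (factor gω i B) (α ∷ [])                 ≡⟨ cong (λ l → binom (factor gω i l) (α ∷ [])) |Y|+t≡B ⟨
  binom (factor gω i (length Y + t)) (α ∷ [])    ≡⟨ cong (λ u → binom u (α ∷ [])) (proj₂ occurs) ⟩
  binom (Y ++ replicate t α) (α ∷ [])            ≡⟨ binom-bits-++-α-run t Y-bits ⟩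
  t                                              ∎)
  where
  open ≡-Reasoning
  r = pow2 B ∸ (B ∸ t)
  Y = drop r (thueMorse B)
  TM≡XY : thueMorse B ≡ take r (thueMorse B) ++ Y
  TM≡XY = sym (take++drop≡id r (thueMorse B))
  occurs = suffix-α-run-occurs B t (take r (thueMorse B) , TM≡XY) (≤-trans t≤B (<⇒≤ (n<pow2 B)))
  i = proj₁ occurs
  Y-bits : All IsBit Y
  Y-bits = ++⁻ʳ (take r (thueMorse B)) (subst (All IsBit) TM≡XY (All-IsBit-thueMorse B))
  |Y|+t≡B : length Y + t ≡ B
  |Y|+t≡B = begin
    length Y + t                              ≡⟨ cong (_+ t) (length-drop r (thueMorse B)) ⟩
    length (thueMorse B) ∸ r + t              ≡⟨ cong (λ l → l ∸ r + t) (length-thueMorse B) ⟩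
    pow2 B ∸ (pow2 B ∸ (B ∸ t)) + t           ≡⟨ cong (_+ t) (m∸[m∸n]≡n (≤-trans (m∸n≤m B t) (<⇒≤ (n<pow2 B)))) ⟩
    B ∸ t + t                                 ≡⟨ m∸n+n≡m t≤B ⟩
    B                                         ∎

abelian-unbounded : AbelianUnbounded gω
abelian-unbounded B with gω-hasClassCount 1 B
... | m , count = B , m , count , ClassCount.≤-classCount gω 1 B count ps separated
  where
  occurs : (t : Fin (suc B)) → ∃ λ i → binom (factor gω i B) (α ∷ []) ≡ toℕ t
  occurs t = α-count-occurs (toℕ t) (s≤s⁻¹ (toℕ<n t))
  ps : Fin (suc B) → ℕ
  ps t = proj₁ (occurs t)
  separated : ∀ p q → p ≢ q → ¬ factor gω (ps p) B ∼[ 1 ] factor gω (ps q) B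
  separated p q p≢q p∼q = p≢q (toℕ-injective (begin
    toℕ p                                  ≡⟨ proj₂ (occurs p) ⟨
    binom (factor gω (ps p) B) (α ∷ [])    ≡⟨ p∼q (α ∷ []) ≤-refl ⟩
    binom (factor gω (ps q) B) (α ∷ [])    ≡⟨ proj₂ (occurs q) ⟩
    toℕ q                                  ∎))
    where open ≡-Reasoning

proposition6p1 : AbelianUnbounded gω × ((k : ℕ) → 1 ≤ k → Prec gω k (suc k))
proposition6p1 = abelian-unbounded , b-strictly-increases
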